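{- Let $L$ be a binary $\mathbb{Z}_2$-lattice with $\mathfrak sL=\mathbb{Z}_2$ and $\mathbb{Q}_2L\cong\mathbb{H}$ (the hyperbolic plane). Let $s,t$ be integers with $t>2s=\operatorname{ord}_2 dL$. Let $z$ be a primitive vector of $L$ with $\operatorname{ord}_2Q(z)=t+1$, and let $w\in L$ satisfy $\operatorname{ord}_2B(z,w)=t$. Then $\operatorname{ord}_2Q(w)\ge t+2$.
   Context: A $\mathbb{Z}_2$-lattice is a finitely generated $\mathbb{Z}_2$-submodule of a quadratic $\mathbb{Q}_2$-space with symmetric bilinear form $B$, $Q(v)=B(v,v)$, assumed integral and nondegenerate; $\mathbb{Q}_2L$ is the space it spans; $\mathfrak sL=B(L,L)$. $dL$ is the determinant of a Gram matrix of $L$ (its $2$-adic order is well defined). A vector is primitive if it spans a direct summand. $\operatorname{ord}_2$ is the $2$-adic valuation, with $\operatorname{ord}_2 0=\infty$. $\mathbb{H}$ is the $\mathbb{Q}_2$-space with Gram matrix $\begin{pmatrix}0&1\\1&0\end{pmatrix}$. -}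

module Defs where

open import Data.Nat as ℕ using (ℕ; zero; suc)
open import Data.Integer as ℤ using (ℤ; +_; _+_; _*_; -_; _-_)
open import Data.Integer.Divisibility.Signed
open import Data.Product using (Σ; ∃; ∃-syntax; _×_; _,_)
open import Relation.Nullary using (¬_)
open import Relation.Binary.PropositionalEquality using (_≡_; refl; cong; sym; trans)
open import Data.Integer.Solver using (module +-*-Solver)
open +-*-Solver
open import Data.Integer.Properties using (+-inverseʳ; *-zeroˡ)

-- 2-adic integers ℤ₂, modelled as coherent sequences of integer
-- approximations: x = (x₀, x₁, …) with x (n+1) ≡ x n (mod 2ⁿ).
-- The element represented is lim x n; x n is its class mod 2ⁿ.

pow2 : ℕ → ℤ
pow2 n = + (2 ℕ.^ n)

record ℤ₂ : Set where
  constructor mkℤ₂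
  field
    approx : ℕ → ℤ
    coh    : ∀ n → pow2 n ∣ (approx (suc n) - approx n)
open ℤ₂ public

_≈₂_ : ℤ₂ → ℤ₂ → Set
x ≈₂ y = ∀ n → pow2 n ∣ (approx x n - approx y n)

ι : ℤ → ℤ₂
ι c = mkℤ₂ (λ _ → c) (λ n → divides (+ 0) (eq n))
  where
  eq : ∀ n → c - c ≡ + 0 * pow2 n
  eq n = trans (+-inverseʳ c) (sym (*-zeroˡ (pow2 n)))

_+₂_ : ℤ₂ → ℤ₂ → ℤ₂
x +₂ y = mkℤ₂ (λ n → approx x n + approx y n) pf
  where
  pf : ∀ n → pow2 n ∣ ((approx x (suc n) + approx y (suc n)) - (approx x n + approx y n))
  pf n = subst∣ (lemma (approx x (suc n)) (approx y (suc n)) (approx x n) (approx y n))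
                (∣m∣n⇒∣m+n (coh x n) (coh y n))
    where
    subst∣ : ∀ {a b} → a ≡ b → pow2 n ∣ a → pow2 n ∣ b
    subst∣ refl p = p
    lemma : ∀ a b c d → (a - c) + (b - d) ≡ (a + b) - (c + d)
    lemma = solve 4 (λ a b c d → (a :- c) :+ (b :- d) := (a :+ b) :- (c :+ d)) refl

_*₂_ : ℤ₂ → ℤ₂ → ℤ₂
x *₂ y = mkℤ₂ (λ n → approx x n * approx y n) pf
  where
  pf : ∀ n → pow2 n ∣ ((approx x (suc n) * approx y (suc n)) - (approx x n * approx y n))
  pf n = subst∣ (lemma (approx x (suc n)) (approx y (suc n)) (approx x n) (approx y n))
                (∣m∣n⇒∣m+n (∣n⇒∣m*n (approx x (suc n)) (coh y n))
                           (∣m⇒∣m*n (approx y n) (coh x n)))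
    where
    subst∣ : ∀ {a b} → a ≡ b → pow2 n ∣ a → pow2 n ∣ b
    subst∣ refl p = p
    lemma : ∀ a b c d → a * (b - d) + (a - c) * d ≡ a * b - c * d
    lemma = solve 4 (λ a b c d → a :* (b :- d) :+ (a :- c) :* d := a :* b :- c :* d) refl

-- ord₂ x ≥ k   (x ≡ 0 mod 2ᵏ; vacuous-free: ord₂ 0 = ∞ satisfies all)
ord≥ : ℤ₂ → ℕ → Set
ord≥ x k = pow2 k ∣ approx x k

ord≡ : ℤ₂ → ℕ → Set
ord≡ x k = ord≥ x k × ¬ ord≥ x (suc k)

nonzero₂ : ℤ₂ → Set
nonzero₂ x = ∃[ k ] ¬ ord≥ x k

-- A binary lattice L is free of rank 2; we fix a
-- basis e₁,e₂ and record its Gram matrix [[a , b],[b , c]] with entries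
-- in ℤ₂ (integrality).  Vectors of L = coordinate pairs in ℤ₂².

record Gram : Set where
  constructor gram
  field
    a b c : ℤ₂
open Gram public

Vec₂ : Set
Vec₂ = ℤ₂ × ℤ₂

B : Gram → Vec₂ → Vec₂ → ℤ₂
B G (x₁ , x₂) (y₁ , y₂) =
  ((a G *₂ (x₁ *₂ y₁)) +₂ (b G *₂ ((x₁ *₂ y₂) +₂ (x₂ *₂ y₁)))) +₂ (c G *₂ (x₂ *₂ y₂))

Q : Gram → Vec₂ → ℤ₂
Q G v = B G v v

det₂ : Vec₂ → Vec₂ → ℤ₂
det₂ (u₁ , u₂) (v₁ , v₂) = (u₁ *₂ v₂) +₂ (ι (- + 1) *₂ (u₂ *₂ v₁))

dL : Gram → ℤ₂
dL G = (a G *₂ c G) +₂ (ι (- + 1) *₂ (b G *₂ b G))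

unit₂ : ℤ₂ → Set
unit₂ x = ord≡ x 0

-- 𝔰L = B(L,L) = ℤ₂ : the ideal generated by B(L,L) (already ⊆ ℤ₂ by
-- integrality) is all of ℤ₂, i.e. (ℤ₂ local) some B(x,y) is a unit.
scaleIsℤ₂ : Gram → Set
scaleIsℤ₂ G = ∃[ x ] ∃[ y ] unit₂ (B G x y)

-- z is primitive: ℤ₂ z is a direct summand of L, i.e. (rank 2) z
-- extends to a basis {z , w} of L (det of base change is a unit).
isPrimitive : Vec₂ → Set
isPrimitive z = ∃[ w ] unit₂ (det₂ z w)

-- ℚ₂L ≅ ℍ : there is a ℚ₂-linear isomorphism ℍ → ℚ₂L preserving forms,
-- i.e. a basis u , v of ℚ₂L with Q u = Q v = 0 and B(u,v) = 1.  Clearing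
-- denominators (u , v ↦ 2ᵐu , 2ᵐv with u , v ∈ L) this reads: there are
-- u , v ∈ L with det(u,v) ≠ 0, Q u = Q v = 0 and B(u,v) = 4ᵐ = 2²ᵐ.
isHyperbolicPlane : Gram → Set
isHyperbolicPlane G =
  ∃[ m ] ∃[ u ] ∃[ v ]
    nonzero₂ (det₂ u v) × (Q G u ≈₂ ι (+ 0)) × (Q G v ≈₂ ι (+ 0))
      × (B G u v ≈₂ ι (pow2 (2 ℕ.* m)))

-- Everything is computed with the level-N approximations for one large N, which turn L into
-- an integer binary form. Complete z to a basis z, y, so that e = det(z, y) is odd, and write
-- e w = α z + β y with α = det(w, y), β = det(z, w) (Cramer's rule). The identity
-- B(z,y)² = Q(z) Q(y) − d e² gives ord B(z,y) = s; then e B(z,w) = α Q(z) + β B(z,y) gives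
-- ord β = t − s, and
--   e² Q(w) = α (α Q(z) + 2 β B(z,y)) + β² Q(y).
-- The first summand is divisible by 2^(t+2) by a parity argument, the second because
-- 2(t − s) ≥ t + 2 unless t = 2s + 1. In that case Q(y) is even: otherwise the odd number
-- r₀ = B(z,y)/2^s satisfies r₀² ≡ 4 − d₀ mod 8, where d₀ is the odd part of d; but ℚ₂L ≅ ℍ
-- makes −d₀ a square, so d₀ ≡ −1 and r₀² ≡ 5 mod 8, which is impossible.
module Submission where

open import Defs

module TwoAdicOrder where
  open import Data.Nat as ℕ using (ℕ; zero; suc; _≤_; _<_)
  import Data.Nat.Properties as ℕ
  import Data.Nat.Divisibility as ℕ using (∣⇒≤)
  open import Data.Integer using (ℤ; +_; -_; _+_; _-_; _*_; NonZero)
  import Data.Integer.Properties as ℤ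
  open import Data.Integer.DivMod using (_%ℕ_; _/ℕ_; n%ℕd<d; a≡a%ℕn+[a/ℕn]*n)
  open import Data.Integer.Divisibility.Signed
  open import Data.Integer.Tactic.RingSolver using (solve-∀; solve)
  open import Algebra.Properties.CommutativeSemigroup ℤ.*-commutativeSemigroup using (interchange)
  open import Data.List using (_∷_; [])
  open import Data.Product using (∃-syntax; _×_; _,_)
  open import Data.Sum using (_⊎_; inj₁; inj₂)
  open import Data.Empty using (⊥-elim)
  open import Relation.Binary.Definitions using (tri<; tri≈; tri>)
  open import Relation.Nullary using (¬_; yes; no)
  open import Relation.Binary.PropositionalEquality
  open ≡-Reasoning

  Odd : ℤ → Set
  Odd x = ∃[ h ] x ≡ + 1 + + 2 * h

  parity : ∀ x → + 2 ∣ x ⊎ Odd x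
  parity x with x %ℕ 2 | n%ℕd<d x 2 | a≡a%ℕn+[a/ℕn]*n x 2
  ... | 0           | _                  | x≡ = inj₁ (divides (x /ℕ 2) (trans x≡ (ℤ.+-identityˡ _)))
  ... | 1           | _                  | x≡ = inj₂ (x /ℕ 2 , trans x≡ (cong (_+_ (+ 1)) (ℤ.*-comm (x /ℕ 2) (+ 2))))
  ... | suc (suc _) | ℕ.s≤s (ℕ.s≤s ()) | _

  2∤1 : ¬ + 2 ∣ + 1
  2∤1 2∣1 with ℕ.∣⇒≤ (∣⇒∣ᵤ 2∣1)
  ... | ℕ.s≤s ()

  odd⇒¬2∣ : ∀ {x} → Odd x → ¬ + 2 ∣ x
  odd⇒¬2∣ (h , refl) 2∣x = 2∤1 (∣m+n∣n⇒∣m 2∣x (divides h (ℤ.*-comm (+ 2) h)))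

  odd-* : ∀ {x y} → Odd x → Odd y → Odd (x * y)
  odd-* (h , refl) (k , refl) = h + k + + 2 * h * k , solve (h ∷ k ∷ [])

  odd-neg : ∀ {x} → Odd x → Odd (- x)
  odd-neg (h , refl) = - h - + 1 , solve (h ∷ [])

  odd+odd : ∀ {x y} → Odd x → Odd y → + 2 ∣ x + y
  odd+odd (h , refl) (k , refl) = divides (+ 1 + h + k) (solve (h ∷ k ∷ []))

  pow2-suc : ∀ n → pow2 (suc n) ≡ + 2 * pow2 n
  pow2-suc n = ℤ.pos-* 2 (2 ℕ.^ n)

  pow2-+ : ∀ m n → pow2 (m ℕ.+ n) ≡ pow2 m * pow2 n
  pow2-+ m n = trans (cong +_ (ℕ.^-distribˡ-+-* 2 m n)) (ℤ.pos-* (2 ℕ.^ m) (2 ℕ.^ n))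

  pow2-∸ : ∀ {m n} → m ≤ n → pow2 n ≡ pow2 (n ℕ.∸ m) * pow2 m
  pow2-∸ {m} {n} m≤n = trans (cong pow2 (sym (ℕ.m∸n+n≡m m≤n))) (pow2-+ (n ℕ.∸ m) m)

  pow2≢0 : ∀ n → NonZero (pow2 n)
  pow2≢0 n = ℕ.m^n≢0 2 n

  pow2-∣ : ∀ {m n} → m ≤ n → pow2 m ∣ pow2 n
  pow2-∣ {m} {n} m≤n = divides (pow2 (n ℕ.∸ m)) (pow2-∸ m≤n)

  *-pres-∣ : ∀ {i j x y} → i ∣ x → j ∣ y → i * j ∣ x * y
  *-pres-∣ {i} {j} {x} {y} i∣x j∣y = ∣-trans (*-monoˡ-∣ j i∣x) (*-monoʳ-∣ x j∣y)

  record ord≡ℤ (x : ℤ) (k : ℕ) : Set where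
    constructor mkOrd
    field
      unit : ℤ
      odd  : Odd unit
      eq   : x ≡ pow2 k * unit

  odd⇒ord≡ℤ0 : ∀ {x} → Odd x → ord≡ℤ x 0
  odd⇒ord≡ℤ0 {x} x-odd = mkOrd x x-odd (sym (ℤ.*-identityˡ x))

  ord≡ℤ0⇒odd : ∀ {x} → ord≡ℤ x 0 → Odd x
  ord≡ℤ0⇒odd (mkOrd o o-odd refl) = subst Odd (sym (ℤ.*-identityˡ o)) o-odd

  2-ord : ord≡ℤ (+ 2) 1
  2-ord = mkOrd (+ 1) (+ 0 , refl) refl

  ord≡ℤ⇒∣ : ∀ {x a b} → ord≡ℤ x a → b ≤ a → pow2 b ∣ x
  ord≡ℤ⇒∣ {a = a} (mkOrd o _ refl) b≤a = ∣-trans (pow2-∣ b≤a) (divides o (ℤ.*-comm (pow2 a) o))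

  ord≡ℤ⇒¬∣ : ∀ {x a} → ord≡ℤ x a → ¬ pow2 (suc a) ∣ x
  ord≡ℤ⇒¬∣ {a = a} (mkOrd o o-odd refl) ∣x = odd⇒¬2∣ o-odd (*-cancelˡ-∣ (pow2 a) {{pow2≢0 a}} 2^a*2∣2^a*o)
    where
    2^a*2∣2^a*o : pow2 a * + 2 ∣ pow2 a * o
    2^a*2∣2^a*o = subst (_∣ pow2 a * o) (trans (pow2-suc a) (ℤ.*-comm (+ 2) (pow2 a))) ∣x

  ∣∧¬∣⇒ord≡ℤ : ∀ {k x} → pow2 k ∣ x → ¬ pow2 (suc k) ∣ x → ord≡ℤ x k
  ∣∧¬∣⇒ord≡ℤ {k} (divides q refl) ∤x with parity q
  ... | inj₁ 2∣q   = ⊥-elim (∤x (subst (_∣ q * pow2 k) (sym (pow2-suc k)) (*-monoˡ-∣ (pow2 k) 2∣q)))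
  ... | inj₂ q-odd = mkOrd q q-odd (ℤ.*-comm q (pow2 k))

  ¬∣⇒ord≡ℤ : ∀ k {x} → ¬ pow2 k ∣ x → ∃[ j ] j < k × ord≡ℤ x j
  ¬∣⇒ord≡ℤ zero {x} 1∤x = ⊥-elim (1∤x (divides x (sym (ℤ.*-identityʳ x))))
  ¬∣⇒ord≡ℤ (suc k) {x} ∤x with pow2 k ∣? x
  ... | yes ∣x = k , ℕ.n<1+n k , ∣∧¬∣⇒ord≡ℤ ∣x ∤x
  ... | no ∤x′ with ¬∣⇒ord≡ℤ k ∤x′
  ...   | j , j<k , x-j = j , ℕ.m<n⇒m<1+n j<k , x-j

  ord≡ℤ-unique : ∀ {x a b} → ord≡ℤ x a → ord≡ℤ x b → a ≡ b
  ord≡ℤ-unique {a = a} {b} x-a x-b with ℕ.<-cmp a b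
  ... | tri< a<b _ _ = ⊥-elim (ord≡ℤ⇒¬∣ x-a (ord≡ℤ⇒∣ x-b a<b))
  ... | tri≈ _ a≡b _ = a≡b
  ... | tri> _ _ b<a = ⊥-elim (ord≡ℤ⇒¬∣ x-b (ord≡ℤ⇒∣ x-a b<a))

  odd-part-unique : ∀ {x a b o o′} → Odd o → Odd o′ → x ≡ pow2 a * o → x ≡ pow2 b * o′ → o ≡ o′
  odd-part-unique {a = a} {b} o-odd o′-odd x≡ x≡′
    with ord≡ℤ-unique {a = a} {b} (mkOrd _ o-odd x≡) (mkOrd _ o′-odd x≡′)
  ... | refl = ℤ.*-cancelˡ-≡ (pow2 a) _ _ {{pow2≢0 a}} (trans (sym x≡) x≡′)

  ord≡ℤ-* : ∀ {x y a b} → ord≡ℤ x a → ord≡ℤ y b → ord≡ℤ (x * y) (a ℕ.+ b)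
  ord≡ℤ-* {a = a} {b} (mkOrd o o-odd refl) (mkOrd o′ o′-odd refl) =
    mkOrd (o * o′) (odd-* o-odd o′-odd)
      (trans (interchange (pow2 a) o (pow2 b) o′) (cong (_* (o * o′)) (sym (pow2-+ a b))))

  ord≡ℤ-*-odd : ∀ {x y a} → ord≡ℤ x a → Odd y → ord≡ℤ (x * y) a
  ord≡ℤ-*-odd {a = a} x-a y-odd = subst (ord≡ℤ _) (ℕ.+-identityʳ a) (ord≡ℤ-* x-a (odd⇒ord≡ℤ0 y-odd))

  ord≡ℤ-neg : ∀ {x a} → ord≡ℤ x a → ord≡ℤ (- x) a
  ord≡ℤ-neg {a = a} (mkOrd o o-odd refl) = mkOrd (- o) (odd-neg o-odd) (ℤ.neg-distribʳ-* (pow2 a) o)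

  ord≡ℤ-+ : ∀ {x y a} → ord≡ℤ x a → pow2 (suc a) ∣ y → ord≡ℤ (x + y) a
  ord≡ℤ-+ {a = a} (mkOrd o (h , refl) refl) (divides k refl) =
    mkOrd (+ 1 + + 2 * (h + k)) (h + k , refl)
      (trans (cong (λ P → pow2 a * (+ 1 + + 2 * h) + k * P) (pow2-suc a)) (shift (pow2 a) h k))
    where
    shift : ∀ P h k → P * (+ 1 + + 2 * h) + k * (+ 2 * P) ≡ P * (+ 1 + + 2 * (h + k))
    shift P h k = solve (P ∷ h ∷ k ∷ [])

  ord≡ℤ-+-same : ∀ {x y a} → ord≡ℤ x a → ord≡ℤ y a → pow2 (suc a) ∣ x + y
  ord≡ℤ-+-same {a = a} (mkOrd o o-odd refl) (mkOrd o′ o′-odd refl) =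
    subst₂ _∣_ (sym (trans (pow2-suc a) (ℤ.*-comm (+ 2) (pow2 a)))) (ℤ.*-distribˡ-+ (pow2 a) o o′)
      (*-monoʳ-∣ (pow2 a) (odd+odd o-odd o′-odd))

  ord≡ℤ-cancelʳ : ∀ {x y a b} → ord≡ℤ (x * y) (a ℕ.+ b) → ord≡ℤ y b → ord≡ℤ x a
  ord≡ℤ-cancelʳ {x} {y} {a} {b} xy-ord y-ord
    with ¬∣⇒ord≡ℤ (suc (a ℕ.+ b)) {x} (λ ∣x → ord≡ℤ⇒¬∣ xy-ord (∣m⇒∣m*n y ∣x))
  ... | j , _ , x-j = subst (ord≡ℤ x) (ℕ.+-cancelʳ-≡ b j a (ord≡ℤ-unique (ord≡ℤ-* x-j y-ord) xy-ord)) x-j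

  ord≡ℤ-sqrt : ∀ {x a} → ord≡ℤ (x * x) (a ℕ.+ a) → ord≡ℤ x a
  ord≡ℤ-sqrt {x} {a} x²-ord
    with ¬∣⇒ord≡ℤ (suc (a ℕ.+ a)) {x} (λ ∣x → ord≡ℤ⇒¬∣ x²-ord (∣m⇒∣m*n x ∣x))
  ... | j , _ , x-j = subst (ord≡ℤ x) (half (ord≡ℤ-unique (ord≡ℤ-* x-j x-j) x²-ord)) x-j
    where
    half : ∀ {m n} → m ℕ.+ m ≡ n ℕ.+ n → m ≡ n
    half {m} {n} eq = trans (ℕ.n≡⌊n+n/2⌋ m) (trans (cong ℕ.⌊_/2⌋ eq) (sym (ℕ.n≡⌊n+n/2⌋ n)))

  ∣-cancel-odd : ∀ {k x y} → Odd y → pow2 k ∣ y * x → pow2 k ∣ x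
  ∣-cancel-odd {k} {x} y-odd ∣yx with pow2 k ∣? x
  ... | yes ∣x = ∣x
  ... | no ∤x with ¬∣⇒ord≡ℤ k ∤x
  ...   | j , j<k , x-j = ⊥-elim (ord≡ℤ⇒¬∣ (ord≡ℤ-* (odd⇒ord≡ℤ0 y-odd) x-j) (∣-trans (pow2-∣ j<k) ∣yx))

  infix 4 _≡_[mod_]
  _≡_[mod_] : ℤ → ℤ → ℕ → Set
  x ≡ y [mod m ] = ∃[ k ] x ≡ y + + m * k

  odd²≡1[mod8] : ∀ {x} → Odd x → x * x ≡ + 1 [mod 8 ]
  odd²≡1[mod8] (h , refl) with parity h
  ... | inj₁ (divides g refl) = g + + 2 * g * g , h-even g
    where
    h-even : ∀ g → (+ 1 + + 2 * (g * + 2)) * (+ 1 + + 2 * (g * + 2)) ≡ + 1 + + 8 * (g + + 2 * g * g)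
    h-even = solve-∀
  ... | inj₂ (g , refl)       = + 1 + + 3 * g + + 2 * g * g , h-odd g
    where
    h-odd : ∀ g → (+ 1 + + 2 * (+ 1 + + 2 * g)) * (+ 1 + + 2 * (+ 1 + + 2 * g))
                  ≡ + 1 + + 8 * (+ 1 + + 3 * g + + 2 * g * g)
    h-odd = solve-∀

  odd²-cancel[mod8] : ∀ {x y D} → Odd D → x * (D * D) ≡ y [mod 8 ] → x ≡ y [mod 8 ]
  odd²-cancel[mod8] {x} {y} {D} D-odd (k , xD²≡) with odd²≡1[mod8] D-odd
  ... | b , D²≡ = k - b * x , (begin
    x                                   ≡⟨ split x b ⟩
    x * (+ 1 + + 8 * b) - + 8 * (b * x) ≡⟨ cong (λ E → x * E - + 8 * (b * x)) (sym D²≡) ⟩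
    x * (D * D) - + 8 * (b * x)         ≡⟨ cong (_- + 8 * (b * x)) xD²≡ ⟩
    y + + 8 * k - + 8 * (b * x)         ≡⟨ collect y k (b * x) ⟩
    y + + 8 * (k - b * x)               ∎)
    where
    split : ∀ x b → x ≡ x * (+ 1 + + 8 * b) - + 8 * (b * x)
    split = solve-∀
    collect : ∀ y k v → y + + 8 * k - + 8 * v ≡ y + + 8 * (k - v)
    collect = solve-∀

  odd²≢5[mod8] : ∀ {x} → Odd x → ¬ x * x ≡ + 5 [mod 8 ]
  odd²≢5[mod8] {x} x-odd (k , x²≡5) with odd²≡1[mod8] x-odd
  ... | b , x²≡1 = odd⇒¬2∣ (k - b , sym (ℤ.*-cancelˡ-≡ (+ 4) _ (+ 0) 4*odd≡0)) (divides (+ 0) refl)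
    where
    gap : ∀ k b → + 4 * (+ 1 + + 2 * (k - b)) ≡ (+ 5 + + 8 * k) - (+ 1 + + 8 * b)
    gap = solve-∀
    4*odd≡0 : + 4 * (+ 1 + + 2 * (k - b)) ≡ + 4 * + 0
    4*odd≡0 = begin
      + 4 * (+ 1 + + 2 * (k - b))       ≡⟨ gap k b ⟩
      (+ 5 + + 8 * k) - (+ 1 + + 8 * b) ≡⟨ cong₂ _-_ (sym x²≡5) (sym x²≡1) ⟩
      x * x - x * x                     ≡⟨ ℤ.+-inverseʳ (x * x) ⟩
      + 0                               ∎

  4xy-dz²≡5[mod8] : ∀ {x y z d} → Odd x → Odd y → Odd z → d ≡ - + 1 [mod 8 ]
    → + 4 * (x * y) - d * (z * z) ≡ + 5 [mod 8 ]
  4xy-dz²≡5[mod8] (h , refl) (k , refl) z-odd (c , refl) with odd²≡1[mod8] z-odd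
  ... | b , z²≡ = h + k + + 2 * h * k + b - c - + 8 * b * c ,
      trans (cong (λ E → + 4 * ((+ 1 + + 2 * h) * (+ 1 + + 2 * k)) - (- + 1 + + 8 * c) * E) z²≡) (expand h k b c)
    where
    expand : ∀ h k b c → + 4 * ((+ 1 + + 2 * h) * (+ 1 + + 2 * k)) - (- + 1 + + 8 * c) * (+ 1 + + 8 * b)
                         ≡ + 5 + + 8 * (h + k + + 2 * h * k + b - c - + 8 * b * c)
    expand = solve-∀

  xy-z²≡-4ⁿ[mod8·4ⁿ] : ∀ {N n x y z} → 3 ℕ.+ (n ℕ.+ n) ≤ N
    → x ≡ + 0 [mod 2 ℕ.^ N ] → y ≡ + 0 [mod 2 ℕ.^ N ] → z ≡ pow2 n [mod 2 ℕ.^ N ]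
    → ∃[ W ] x * y - z * z ≡ pow2 (n ℕ.+ n) * (- + 1 + + 8 * W)
  xy-z²≡-4ⁿ[mod8·4ⁿ] {N} {n} bound (k₁ , refl) (k₂ , refl) (k₃ , refl) = W , (begin
    (+ 0 + pow2 N * k₁) * (+ 0 + pow2 N * k₂) - (M + pow2 N * k₃) * (M + pow2 N * k₃)
      ≡⟨ cong (λ P → (+ 0 + P * k₁) * (+ 0 + P * k₂) - (M + P * k₃) * (M + P * k₃)) pow2N≡T ⟩
    (+ 0 + T * k₁) * (+ 0 + T * k₂) - (M + T * k₃) * (M + T * k₃)
      ≡⟨ expand M K k₁ k₂ k₃ ⟩
    M * M * (- + 1 + + 8 * W)
      ≡⟨ cong (_* (- + 1 + + 8 * W)) (sym (pow2-+ n n)) ⟩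
    pow2 (n ℕ.+ n) * (- + 1 + + 8 * W)
      ∎)
    where
    M K T W : ℤ
    M = pow2 n
    K = pow2 (N ℕ.∸ (3 ℕ.+ (n ℕ.+ n)))
    T = M * M * + 8 * K
    W = K * (T * (k₁ * k₂ - k₃ * k₃) - + 2 * M * k₃)
    rotate : ∀ K M → K * (+ 8 * (M * M)) ≡ M * M * + 8 * K
    rotate = solve-∀
    pow2N≡T : pow2 N ≡ T
    pow2N≡T = begin
      pow2 N                     ≡⟨ pow2-∸ bound ⟩
      K * pow2 (3 ℕ.+ (n ℕ.+ n)) ≡⟨ cong (K *_) (trans (pow2-+ 3 (n ℕ.+ n)) (cong (+ 8 *_) (pow2-+ n n))) ⟩
      K * (+ 8 * (M * M))        ≡⟨ rotate K M ⟩
      T                          ∎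
    expand : ∀ M K k₁ k₂ k₃ → let T = M * M * + 8 * K in
      (+ 0 + T * k₁) * (+ 0 + T * k₂) - (M + T * k₃) * (M + T * k₃)
        ≡ M * M * (- + 1 + + 8 * (K * (T * (k₁ * k₂ - k₃ * k₃) - + 2 * M * k₃)))
    expand = solve-∀

module IntegerForms where
  open import Data.Nat as ℕ using (ℕ; suc; _≤_; _<_)
  import Data.Nat.Properties as ℕ
  open import Data.Integer using (ℤ; +_; -_; _+_; _-_; _*_)
  import Data.Integer.Properties as ℤ
  open import Data.Integer.Divisibility.Signed
  open import Data.Integer.Tactic.RingSolver using (solve-∀)
  open import Algebra.Properties.CommutativeSemigroup ℤ.*-commutativeSemigroup using (interchange)
  open import Data.Product using (_×_; _,_)
  open import Data.Sum using (inj₁; inj₂)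
  open import Data.Empty using (⊥-elim)
  open import Relation.Binary.PropositionalEquality
  open ≡-Reasoning
  open TwoAdicOrder

  record Formℤ : Set where
    constructor formℤ
    field
      a b c : ℤ

  ℤ² : Set
  ℤ² = ℤ × ℤ

  -- Bℤ, detℤ and discℤ are written exactly as B, det₂ and dL in Defs, so that for instance
  -- approx (B G x y) N is Bℤ (approxᴳ G N) (approxᵛ x N) (approxᵛ y N) by definition.
  Bℤ : Formℤ → ℤ² → ℤ² → ℤ
  Bℤ (formℤ a b c) (x₁ , x₂) (y₁ , y₂) = a * (x₁ * y₁) + b * (x₁ * y₂ + x₂ * y₁) + c * (x₂ * y₂)

  Qℤ : Formℤ → ℤ² → ℤ
  Qℤ F x = Bℤ F x x

  detℤ : ℤ² → ℤ² → ℤ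
  detℤ (x₁ , x₂) (y₁ , y₂) = x₁ * y₂ + - + 1 * (x₂ * y₁)

  discℤ : Formℤ → ℤ
  discℤ (formℤ a b c) = a * c + - + 1 * (b * b)

  gram-det : ∀ F x y → Qℤ F x * Qℤ F y - Bℤ F x y * Bℤ F x y ≡ discℤ F * (detℤ x y * detℤ x y)
  gram-det (formℤ a b c) (x₁ , x₂) (y₁ , y₂) = expanded a b c x₁ x₂ y₁ y₂
    where
    expanded : ∀ a b c x₁ x₂ y₁ y₂ →
      let B : ℤ → ℤ → ℤ → ℤ → ℤ
          B u₁ u₂ v₁ v₂ = a * (u₁ * v₁) + b * (u₁ * v₂ + u₂ * v₁) + c * (u₂ * v₂)
          det = x₁ * y₂ + - + 1 * (x₂ * y₁)
      in B x₁ x₂ x₁ x₂ * B y₁ y₂ y₁ y₂ - B x₁ x₂ y₁ y₂ * B x₁ x₂ y₁ y₂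
           ≡ (a * c + - + 1 * (b * b)) * (det * det)
    expanded = solve-∀

  B-cramer : ∀ F z y w → detℤ z w * Bℤ F z y ≡ detℤ z y * Bℤ F z w - detℤ w y * Qℤ F z
  B-cramer (formℤ a b c) (z₁ , z₂) (y₁ , y₂) (w₁ , w₂) = expanded a b c z₁ z₂ y₁ y₂ w₁ w₂
    where
    expanded : ∀ a b c z₁ z₂ y₁ y₂ w₁ w₂ →
      let B : ℤ → ℤ → ℤ → ℤ → ℤ
          B u₁ u₂ v₁ v₂ = a * (u₁ * v₁) + b * (u₁ * v₂ + u₂ * v₁) + c * (u₂ * v₂)
          det : ℤ → ℤ → ℤ → ℤ → ℤ
          det u₁ u₂ v₁ v₂ = u₁ * v₂ + - + 1 * (u₂ * v₁)
      in det z₁ z₂ w₁ w₂ * B z₁ z₂ y₁ y₂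
           ≡ det z₁ z₂ y₁ y₂ * B z₁ z₂ w₁ w₂ - det w₁ w₂ y₁ y₂ * B z₁ z₂ z₁ z₂
    expanded = solve-∀

  Q-cramer : ∀ F z y w → let α = detℤ w y; β = detℤ z w in
    detℤ z y * detℤ z y * Qℤ F w ≡ α * (α * Qℤ F z + + 2 * (β * Bℤ F z y)) + β * β * Qℤ F y
  Q-cramer (formℤ a b c) (z₁ , z₂) (y₁ , y₂) (w₁ , w₂) = expanded a b c z₁ z₂ y₁ y₂ w₁ w₂
    where
    expanded : ∀ a b c z₁ z₂ y₁ y₂ w₁ w₂ →
      let B : ℤ → ℤ → ℤ → ℤ → ℤ
          B u₁ u₂ v₁ v₂ = a * (u₁ * v₁) + b * (u₁ * v₂ + u₂ * v₁) + c * (u₂ * v₂)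
          det : ℤ → ℤ → ℤ → ℤ → ℤ
          det u₁ u₂ v₁ v₂ = u₁ * v₂ + - + 1 * (u₂ * v₁)
          α = det w₁ w₂ y₁ y₂
          β = det z₁ z₂ w₁ w₂
      in det z₁ z₂ y₁ y₂ * det z₁ z₂ y₁ y₂ * B w₁ w₂ w₁ w₂
           ≡ α * (α * B z₁ z₂ z₁ z₂ + + 2 * (β * B z₁ z₂ y₁ y₂)) + β * β * B y₁ y₂ y₁ y₂
    expanded = solve-∀

  x-y≡z⇒y≡x-z : ∀ {x y z} → x - y ≡ z → y ≡ x - z
  x-y≡z⇒y≡x-z {x} {y} refl = back x y
    where
    back : ∀ x y → y ≡ x - (x - y)
    back = solve-∀

  hyperbolic⇒disc-unit≡-1[mod8] : ∀ F (u v : ℤ²) {N n j a d₀} → 3 ℕ.+ (n ℕ.+ n) ≤ N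
    → Qℤ F u ≡ + 0 [mod 2 ℕ.^ N ] → Qℤ F v ≡ + 0 [mod 2 ℕ.^ N ] → Bℤ F u v ≡ pow2 n [mod 2 ℕ.^ N ]
    → ord≡ℤ (detℤ u v) j → Odd d₀ → discℤ F ≡ pow2 a * d₀ → d₀ ≡ - + 1 [mod 8 ]
  hyperbolic⇒disc-unit≡-1[mod8] F u v {N} {n} {j} {a} {d₀} bound Qu≡ Qv≡ Buv≡
                                (mkOrd D₀ D₀-odd det≡) d₀-odd disc≡
    with xy-z²≡-4ⁿ[mod8·4ⁿ] {N} {n} bound Qu≡ Qv≡ Buv≡
  ... | W , QQ-B²≡ =
    odd²-cancel[mod8] {y = - + 1} D₀-odd
      (W , odd-part-unique {a = a ℕ.+ (j ℕ.+ j)} {b = n ℕ.+ n} (odd-* d₀-odd (odd-* D₀-odd D₀-odd))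
                           (+ 4 * W - + 1 , -1+8W≡1+2[4W-1] W) refl (trans dD₀²≡QQ-B² QQ-B²≡))
    where
    -1+8W≡1+2[4W-1] : ∀ W → - + 1 + + 8 * W ≡ + 1 + + 2 * (+ 4 * W - + 1)
    -1+8W≡1+2[4W-1] = solve-∀
    regroup : ∀ A J d D → A * (J * J) * (d * (D * D)) ≡ A * d * (J * D * (J * D))
    regroup = solve-∀
    dD₀²≡QQ-B² : pow2 (a ℕ.+ (j ℕ.+ j)) * (d₀ * (D₀ * D₀)) ≡ Qℤ F u * Qℤ F v - Bℤ F u v * Bℤ F u v
    dD₀²≡QQ-B² = begin
      pow2 (a ℕ.+ (j ℕ.+ j)) * (d₀ * (D₀ * D₀))
        ≡⟨ cong (_* (d₀ * (D₀ * D₀))) (trans (pow2-+ a (j ℕ.+ j)) (cong (pow2 a *_) (pow2-+ j j))) ⟩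
      pow2 a * (pow2 j * pow2 j) * (d₀ * (D₀ * D₀))
        ≡⟨ regroup (pow2 a) (pow2 j) d₀ D₀ ⟩
      pow2 a * d₀ * (pow2 j * D₀ * (pow2 j * D₀))
        ≡⟨ sym (cong₂ (λ d D → d * (D * D)) disc≡ det≡) ⟩
      discℤ F * (detℤ u v * detℤ u v)
        ≡⟨ sym (gram-det F u v) ⟩
      Qℤ F u * Qℤ F v - Bℤ F u v * Bℤ F u v
        ∎

  module Lemma6p4ℤ (F : Formℤ) (z y w : ℤ²) {s u : ℕ} (s<u : s < u)
                   {d₀ : ℤ} (d₀-odd : Odd d₀) (d₀≡-1 : d₀ ≡ - + 1 [mod 8 ])
                   (disc≡ : discℤ F ≡ pow2 (s ℕ.+ s) * d₀) (e-odd : Odd (detℤ z y))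
                   (q-ord : ord≡ℤ (Qℤ F z) (suc (u ℕ.+ s))) (g-ord : ord≡ℤ (Bℤ F z w) (u ℕ.+ s)) where

    q r p g e α β : ℤ
    q = Qℤ F z
    r = Bℤ F z y
    p = Qℤ F y
    g = Bℤ F z w
    e = detℤ z y
    α = detℤ w y
    β = detℤ z w

    r²≡ : r * r ≡ q * p - discℤ F * (e * e)
    r²≡ = x-y≡z⇒y≡x-z {q * p} {r * r} (gram-det F z y)

    r-ord : ord≡ℤ r s
    r-ord = ord≡ℤ-sqrt (subst (λ x → ord≡ℤ x (s ℕ.+ s))
      (trans (ℤ.+-comm (- (discℤ F * (e * e))) (q * p)) (sym r²≡))
      (ord≡ℤ-+ (ord≡ℤ-neg (ord≡ℤ-*-odd (mkOrd d₀ d₀-odd disc≡) (odd-* e-odd e-odd)))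
               (∣m⇒∣m*n p (ord≡ℤ⇒∣ q-ord (ℕ.s≤s (ℕ.+-monoˡ-≤ s (ℕ.<⇒≤ s<u)))))))

    βr-ord : ord≡ℤ (β * r) (u ℕ.+ s)
    βr-ord = subst (λ x → ord≡ℤ x (u ℕ.+ s)) (sym (B-cramer F z y w))
      (ord≡ℤ-+ {x = e * g} {y = - (α * q)} (ord≡ℤ-* (odd⇒ord≡ℤ0 e-odd) g-ord)
               (∣m⇒∣-m (∣n⇒∣m*n α (ord≡ℤ⇒∣ q-ord ℕ.≤-refl))))

    2βr-ord : ord≡ℤ (+ 2 * (β * r)) (suc (u ℕ.+ s))
    2βr-ord = ord≡ℤ-* 2-ord βr-ord

    β²-ord : ord≡ℤ (β * β) (u ℕ.+ u)
    β²-ord = let β-ord = ord≡ℤ-cancelʳ {x = β} {y = r} βr-ord r-ord in ord≡ℤ-* β-ord β-ord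

    α-part : pow2 (suc (suc (u ℕ.+ s))) ∣ α * (α * q + + 2 * (β * r))
    α-part with parity α
    ... | inj₁ 2∣α   = subst (_∣ α * (α * q + + 2 * (β * r))) (sym (pow2-suc (suc (u ℕ.+ s))))
                         (*-pres-∣ 2∣α (∣m∣n⇒∣m+n (∣n⇒∣m*n α (ord≡ℤ⇒∣ q-ord ℕ.≤-refl))
                                                  (ord≡ℤ⇒∣ 2βr-ord ℕ.≤-refl)))
    ... | inj₂ α-odd = ∣n⇒∣m*n α (ord≡ℤ-+-same (ord≡ℤ-* (odd⇒ord≡ℤ0 α-odd) q-ord) 2βr-ord)

    u≡1+s⇒2∣p : suc s ≡ u → + 2 ∣ p
    u≡1+s⇒2∣p refl with parity p
    ... | inj₁ 2∣p   = 2∣p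
    ... | inj₂ p-odd =
      ⊥-elim (odd²≢5[mod8] r₀-odd
        (subst (_≡ + 5 [mod 8 ]) (sym r₀²≡) (4xy-dz²≡5[mod8] q₀-odd p-odd e-odd d₀≡-1)))
      where
      open ord≡ℤ r-ord renaming (unit to r₀; odd to r₀-odd; eq to r≡)
      open ord≡ℤ q-ord renaming (unit to q₀; odd to q₀-odd; eq to q≡)
      collect : ∀ P q₀ p d₀ E → + 2 * (+ 2 * P) * q₀ * p - P * d₀ * E ≡ P * (+ 4 * (q₀ * p) - d₀ * E)
      collect = solve-∀
      r₀²≡ : r₀ * r₀ ≡ + 4 * (q₀ * p) - d₀ * (e * e)
      r₀²≡ = ℤ.*-cancelˡ-≡ (pow2 (s ℕ.+ s)) _ _ {{pow2≢0 (s ℕ.+ s)}} (begin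
        pow2 (s ℕ.+ s) * (r₀ * r₀)  ≡⟨ cong (_* (r₀ * r₀)) (pow2-+ s s) ⟩
        pow2 s * pow2 s * (r₀ * r₀) ≡⟨ interchange (pow2 s) (pow2 s) r₀ r₀ ⟩
        pow2 s * r₀ * (pow2 s * r₀) ≡⟨ cong₂ _*_ (sym r≡) (sym r≡) ⟩
        r * r                       ≡⟨ r²≡ ⟩
        q * p - discℤ F * (e * e)   ≡⟨ cong₂ (λ q d → q * p - d * (e * e)) q≡ disc≡ ⟩
        pow2 (suc (suc (s ℕ.+ s))) * q₀ * p - pow2 (s ℕ.+ s) * d₀ * (e * e)
          ≡⟨ cong (λ P → P * q₀ * p - pow2 (s ℕ.+ s) * d₀ * (e * e))
                  (trans (pow2-suc (suc (s ℕ.+ s))) (cong (+ 2 *_) (pow2-suc (s ℕ.+ s)))) ⟩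
        + 2 * (+ 2 * pow2 (s ℕ.+ s)) * q₀ * p - pow2 (s ℕ.+ s) * d₀ * (e * e)
          ≡⟨ collect (pow2 (s ℕ.+ s)) q₀ p d₀ (e * e) ⟩
        pow2 (s ℕ.+ s) * (+ 4 * (q₀ * p) - d₀ * (e * e)) ∎)

    β²p-part : pow2 (suc (suc (u ℕ.+ s))) ∣ β * β * p
    β²p-part with ℕ.m≤n⇒m<n∨m≡n s<u
    ... | inj₁ 1+s<u =
      ∣m⇒∣m*n p (ord≡ℤ⇒∣ β²-ord (ℕ.≤-trans (ℕ.≤-reflexive (sym u+2+s≡)) (ℕ.+-monoʳ-≤ u 1+s<u)))
      where
      u+2+s≡ : u ℕ.+ suc (suc s) ≡ suc (suc (u ℕ.+ s))
      u+2+s≡ = trans (ℕ.+-suc u (suc s)) (cong suc (ℕ.+-suc u s))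
    ... | inj₂ refl  =
      subst (_∣ β * β * p) 2^[2s+2]*2≡2^[2s+3] (*-pres-∣ (ord≡ℤ⇒∣ β²-ord ℕ.≤-refl) (u≡1+s⇒2∣p refl))
      where
      2^[2s+2]*2≡2^[2s+3] : pow2 (suc s ℕ.+ suc s) * + 2 ≡ pow2 (suc (suc (suc s ℕ.+ s)))
      2^[2s+2]*2≡2^[2s+3] = trans (ℤ.*-comm (pow2 (suc s ℕ.+ suc s)) (+ 2))
        (trans (sym (pow2-suc (suc s ℕ.+ suc s))) (cong (λ n → pow2 (suc (suc n))) (ℕ.+-suc s s)))

    Qw-divisible : pow2 (suc (suc (u ℕ.+ s))) ∣ Qℤ F w
    Qw-divisible = ∣-cancel-odd {k = suc (suc (u ℕ.+ s))} {x = Qℤ F w} {y = e * e} (odd-* e-odd e-odd)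
      (subst (pow2 (suc (suc (u ℕ.+ s))) ∣_) (sym (Q-cramer F z y w)) (∣m∣n⇒∣m+n α-part β²p-part))

  lemma6p4ℤ : ∀ F (s t : ℕ) → 2 ℕ.* s < t
    → ∀ {d₀} → Odd d₀ → d₀ ≡ - + 1 [mod 8 ] → discℤ F ≡ pow2 (2 ℕ.* s) * d₀
    → ∀ z y w → Odd (detℤ z y) → ord≡ℤ (Qℤ F z) (t ℕ.+ 1) → ord≡ℤ (Bℤ F z w) t
    → pow2 (t ℕ.+ 2) ∣ Qℤ F w
  lemma6p4ℤ F s t 2s<t {d₀} d₀-odd d₀≡-1 disc≡ z y w e-odd q-ord g-ord =
    subst (λ n → pow2 n ∣ Qℤ F w) (sym (trans (ℕ.+-comm t 2) (cong (λ n → suc (suc n)) t≡u+s)))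
      (Lemma6p4ℤ.Qw-divisible F z y w s<u d₀-odd d₀≡-1
        (subst (λ n → discℤ F ≡ pow2 n * d₀) 2s≡s+s disc≡) e-odd
        (subst (ord≡ℤ (Qℤ F z)) (trans (ℕ.+-comm t 1) (cong suc t≡u+s)) q-ord)
        (subst (ord≡ℤ (Bℤ F z w)) t≡u+s g-ord))
    where
    2s≡s+s : 2 ℕ.* s ≡ s ℕ.+ s
    2s≡s+s = cong (s ℕ.+_) (ℕ.+-identityʳ s)
    1+s+s≤t : suc s ℕ.+ s ≤ t
    1+s+s≤t = subst (λ n → suc n ≤ t) 2s≡s+s 2s<t
    u : ℕ
    u = t ℕ.∸ s
    t≡u+s : t ≡ u ℕ.+ s
    t≡u+s = sym (ℕ.m∸n+n≡m (ℕ.m+n≤o⇒n≤o (suc s) 1+s+s≤t))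
    s<u : s < u
    s<u = ℕ.m+n≤o⇒m≤o∸n (suc s) 1+s+s≤t

module Truncation where
  open import Data.Nat as ℕ using (ℕ; zero; suc; _≤_; _<_)
  import Data.Nat.Properties as ℕ
  open import Data.Integer using (+_; _+_; _-_; _*_)
  import Data.Integer.Properties as ℤ
  open import Data.Integer.Divisibility.Signed
  open import Data.Integer.Tactic.RingSolver using (solve-∀)
  open import Data.Product using (∃-syntax; _,_)
  open import Data.Sum using (inj₁; inj₂)
  open import Relation.Nullary using (¬_)
  open import Relation.Binary.PropositionalEquality
  open TwoAdicOrder
  open IntegerForms

  approxᴳ : Gram → ℕ → Formℤ
  approxᴳ G N = formℤ (approx (a G) N) (approx (b G) N) (approx (c G) N)

  approxᵛ : Vec₂ → ℕ → ℤ²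
  approxᵛ (x₁ , x₂) N = approx x₁ N , approx x₂ N

  private
    telescope : ∀ a b c → (a - b) + (b - c) ≡ a - c
    telescope = solve-∀
    x-y+y≡x : ∀ x y → (x - y) + y ≡ x
    x-y+y≡x = solve-∀

  coh-≤ : ∀ x {k} n → k ≤ n → pow2 k ∣ approx x n - approx x k
  coh-≤ x zero ℕ.z≤n = divides (+ 0) (ℤ.+-inverseʳ (approx x 0))
  coh-≤ x {k} (suc n) k≤1+n with ℕ.m≤n⇒m<n∨m≡n k≤1+n
  ... | inj₂ refl        = divides (+ 0) (ℤ.+-inverseʳ (approx x (suc n)))
  ... | inj₁ (ℕ.s≤s k≤n) = subst (pow2 k ∣_) (telescope (approx x (suc n)) (approx x n) (approx x k))
                             (∣m∣n⇒∣m+n (∣-trans (pow2-∣ k≤n) (coh x n)) (coh-≤ x n k≤n))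

  ord≥-from : ∀ x {k N} → k ≤ N → pow2 k ∣ approx x N → ord≥ x k
  ord≥-from x {k} {N} k≤N ∣x =
    ∣m+n∣m⇒∣n (subst (pow2 k ∣_) (sym (x-y+y≡x (approx x N) (approx x k))) ∣x) (coh-≤ x N k≤N)

  ord≥-at : ∀ x {k N} → k ≤ N → ord≥ x k → pow2 k ∣ approx x N
  ord≥-at x {k} {N} k≤N x≥k =
    subst (pow2 k ∣_) (x-y+y≡x (approx x N) (approx x k)) (∣m∣n⇒∣m+n (coh-≤ x N k≤N) x≥k)

  ord≡-at : ∀ x {k N} → k < N → ord≡ x k → ord≡ℤ (approx x N) k
  ord≡-at x k<N (x≥k , x≱1+k) =
    ∣∧¬∣⇒ord≡ℤ (ord≥-at x (ℕ.<⇒≤ k<N) x≥k) (λ ∣x → x≱1+k (ord≥-from x k<N ∣x))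

  nonzero-at : ∀ x {k N} → k ≤ N → ¬ ord≥ x k → ∃[ j ] ord≡ℤ (approx x N) j
  nonzero-at x {k} k≤N x≱k with ¬∣⇒ord≡ℤ k (λ ∣x → x≱k (ord≥-from x k≤N ∣x))
  ... | j , _ , x-j = j , x-j

  ≈ι-at : ∀ x c N → x ≈₂ ι c → approx x N ≡ c [mod 2 ℕ.^ N ]
  ≈ι-at x c N x≈c with x≈c N
  ... | divides k eq = k , trans (sym (x-y+y≡x (approx x N) c)) (trans (cong (_+ c) eq) (swap k (pow2 N) c))
    where
    swap : ∀ k P c → k * P + c ≡ c + P * k
    swap = solve-∀

open TwoAdicOrder
open IntegerForms
open Truncation
open import Data.Nat using (ℕ; _+_; _*_; _<_; _≤_; s≤s; z≤n)
import Data.Nat.Properties as ℕ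
open import Data.Integer using (+_; -_)
open import Data.Product using (_,_; proj₂)
open import Relation.Binary.PropositionalEquality using (sym)

lemma6p4 : (G : Gram) → scaleIsℤ₂ G → isHyperbolicPlane G
    → (s t : ℕ) → ord≡ (dL G) (2 * s) → 2 * s < t
    → (z : Vec₂) → isPrimitive z → ord≡ (Q G z) (t + 1)
    → (w : Vec₂) → ord≡ (B G z w) t
    → ord≥ (Q G w) (t + 2)
lemma6p4 G _ (m , u , v , (k , det≢0) , Qu≈0 , Qv≈0 , Buv≈) s t dL-ord 2s<t z (y , zy-unit) Qz-ord w Bzw-ord =
  ord≥-from (Q G w) t+2≤N
    (lemma6p4ℤ F s t 2s<t d₀-odd d₀≡-1 disc≡ (approxᵛ z N) (approxᵛ y N) (approxᵛ w N) e-odd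
      (ord≡-at (Q G z) (below ℕ.≤-refl) Qz-ord) (ord≡-at (B G z w) (below (ℕ.m≤m+n t 1)) Bzw-ord))
  where
  N : ℕ
  N = t + 2 + (k + (3 + (2 * m + 2 * m)))
  t+2≤N : t + 2 ≤ N
  t+2≤N = ℕ.m≤m+n (t + 2) (k + (3 + (2 * m + 2 * m)))
  below : ∀ {j} → j ≤ t + 1 → j < N
  below j≤t+1 = ℕ.≤-trans (s≤s j≤t+1) (ℕ.≤-trans (ℕ.≤-reflexive (sym (ℕ.+-suc t 1))) t+2≤N)
  F : Formℤ
  F = approxᴳ G N
  open ord≡ℤ (ord≡-at (dL G) (below (ℕ.≤-trans (ℕ.<⇒≤ 2s<t) (ℕ.m≤m+n t 1))) dL-ord)
    renaming (unit to d₀; odd to d₀-odd; eq to disc≡)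
  d₀≡-1 : d₀ ≡ - + 1 [mod 8 ]
  d₀≡-1 = hyperbolic⇒disc-unit≡-1[mod8] F (approxᵛ u N) (approxᵛ v N) {n = 2 * m} {a = 2 * s}
            (ℕ.≤-trans (ℕ.m≤n+m _ k) (ℕ.m≤n+m _ (t + 2)))
            (≈ι-at (Q G u) (+ 0) N Qu≈0) (≈ι-at (Q G v) (+ 0) N Qv≈0) (≈ι-at (B G u v) (pow2 (2 * m)) N Buv≈)
            (proj₂ (nonzero-at (det₂ u v) (ℕ.≤-trans (ℕ.m≤m+n k _) (ℕ.m≤n+m _ (t + 2))) det≢0))
            d₀-odd disc≡
  e-odd : Odd (approx (det₂ z y) N)
  e-odd = ord≡ℤ0⇒odd (ord≡-at (det₂ z y) (below z≤n) zy-unit)
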